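{- For every integer $k\ge1$, as rational functions in $x$ (the left side being the power series expansion of the right side), \[ \sum_{n\ge0}\sum_{\pi\in\mathrm{PV}^{2,2k-1}_{2n+1}}\mathrm{wt}(\pi)x^{2n+1}=\cfrac{1}{ -V_0x-\cfrac{1}{ -V_1x-\cdots-\cfrac{1}{ -V_{2k-1}x}}}. \]
   Context: $V_0,V_1,\dots$ are indeterminates and the weight of a sequence $\pi=(a_1,\dots,a_N)$ of nonnegative integers is $\mathrm{wt}(\pi)=V_{a_1}\cdots V_{a_N}$. An $\ell$-peak-valley sequence is a sequence $(a_1,\dots,a_N)$ of nonnegative integers such that, setting $a_0=a_{N+1}=0$, for each $i=1,\dots,N$: if $a_i\equiv0\pmod\ell$ then $a_{i-1}>a_i<a_{i+1}$, and if $a_i\equiv-1\pmod\ell$ then $a_{i-1}<a_i>a_{i+1}$. $\mathrm{PV}^{\ell,K}_N$ is the set of such sequences of length $N$ with $0\le a_i\le K$ for all $i$. -}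

module Defs where

open import Data.Nat using (ℕ; zero; suc; _∸_; _%_; _<ᵇ_; _≡ᵇ_; NonZero)
open import Data.Bool using (Bool; true; false; _∧_; if_then_else_)
open import Data.List using (List; []; _∷_; [_]; map; concatMap; foldr; upTo)
open import Algebra.Bundles using (CommutativeRing)

seqs : ℕ → ℕ → List (List ℕ)
seqs zero    K = [ [] ]
seqs (suc N) K = concatMap (λ a → map (a ∷_) (seqs N K)) (upTo (suc K))

-- a_{i+1}, with the convention a_{N+1} = 0.
nextOr0 : List ℕ → ℕ
nextOr0 []      = 0
nextOr0 (b ∷ _) = b

-- The local ℓ-peak-valley condition at a_i, given a_{i-1} and a_{i+1}:
--   a_i ≡ 0 (mod ℓ)  ⇒ a_{i-1} > a_i < a_{i+1}
--   a_i ≡ -1 (mod ℓ) ⇒ a_{i-1} < a_i > a_{i+1}   (i.e. ℓ ∣ a_i + 1)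
okAt : (ℓ : ℕ) .{{_ : NonZero ℓ}} → ℕ → ℕ → ℕ → Bool
okAt ℓ prev a next =
  (if a % ℓ ≡ᵇ 0 then (a <ᵇ prev) ∧ (a <ᵇ next) else true)
  ∧ (if suc a % ℓ ≡ᵇ 0 then (prev <ᵇ a) ∧ (next <ᵇ a) else true)

isPVFrom : (ℓ : ℕ) .{{_ : NonZero ℓ}} → ℕ → List ℕ → Bool
isPVFrom ℓ prev []       = true
isPVFrom ℓ prev (a ∷ as) = okAt ℓ prev a (nextOr0 as) ∧ isPVFrom ℓ a as

-- ℓ-peak-valley sequence (with a_0 = 0).
isPV : (ℓ : ℕ) .{{_ : NonZero ℓ}} → List ℕ → Bool
isPV ℓ = isPVFrom ℓ 0

PV : (ℓ : ℕ) .{{_ : NonZero ℓ}} → (K N : ℕ) → List (List ℕ)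
PV ℓ K N = concatMap (λ π → if isPV ℓ π then [ π ] else []) (seqs N K)

-- Formal power series in x over a commutative ring R, as coefficient
-- functions ℕ → R (polynomials are the finitely supported ones).

module Series {c ℓ'} (R : CommutativeRing c ℓ') where
  open CommutativeRing R

  Ser : Set c
  Ser = ℕ → Carrier

  sumR : List Carrier → Carrier
  sumR = foldr _+_ 0#

  wt : (ℕ → Carrier) → List ℕ → Carrier
  wt V = foldr (λ a r → V a * r) 1#

  _⊛_ : Ser → Ser → Ser
  (f ⊛ g) m = sumR (map (λ i → f i * g (m ∸ i)) (upTo (suc m)))

  _⊝_ : Ser → Ser → Ser
  (f ⊝ g) m = f m - g m

  one : Ser
  one zero    = 1#
  one (suc _) = 0#

  cx : Carrier → Ser → Ser
  cx a f zero    = 0#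
  cx a f (suc m) = a * f m

  pvGF : (ℕ → Carrier) → ℕ → Ser
  pvGF V K m = if m % 2 ≡ᵇ 1 then sumR (map (wt V) (PV 2 K m)) else 0#

  -- The finite continued fraction
  --   1/(-V_j x - 1/(-V_{j+1} x - ⋯ - 1/(-V_{j+r} x)))
  -- evaluated literally as a (numerator , denominator) pair of polynomials,
  -- using 1/(a - p/q) = q/(a q - p).
  record Frac : Set c where
    constructor _/_
    field num den : Ser

  cf : (ℕ → Carrier) → ℕ → ℕ → Frac
  cf V j zero    = one / cx (- V j) one
  cf V j (suc r) with cf V (suc j) r
  ... | p / q = q / (cx (- V j) q ⊝ p)

{-# OPTIONS --safe #-}

-- For ℓ = 2 an even entry must be a valley and an odd entry a peak, so consecutive entries have
-- opposite parity and a sequence in PV^{2,K}_N is a walk from the valley a₀ = 0 to a final peak.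
-- Let P_j be the generating function of the walks from a valley j whose entries all lie in
-- [j, K]. Cutting such a walk at its first return to j gives P_j = B (1 + V_j x P_j), where B
-- counts the walks from j that stay above j, and B = V_{j+1} x + P_{j+2} by splitting off their
-- first step. Hence P_j = 1/(-V_j x - 1/(-V_{j+1} x - P_{j+2})), and since P_{K+1} = 0 for odd K,
-- unfolding from j = 0 gives the continued fraction. The argument runs with numerators and
-- denominators in the commutative ring of formal power series.
module Submission where

open import Defs
open import Algebra.Bundles using (CommutativeRing)
import Algebra.Construct.Pointwise as Pointwise
import Algebra.Properties.Ring as RingProperties
open import Data.Bool using (Bool; true; false; _∧_; not; if_then_else_)
open import Data.Bool.Properties
  using (∧-comm; ∧-idem; ∧-identityʳ; ∧-zeroʳ; not-¬; not-involutive; not-injective; T-≡)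
open import Function.Bundles using (Equivalence)
open import Data.List using (List; []; _∷_; [_]; _++_; map; concatMap; upTo; applyUpTo)
open import Data.List.Properties using (map-upTo; map-∘)
open import Data.Nat
  using (ℕ; zero; suc; _∸_; _≤_; _<_; _%_; _<ᵇ_; _≤ᵇ_; _≡ᵇ_; z≤n; s≤s)
import Data.Nat as Nat
import Data.Nat.Properties as ℕₚ
open import Data.Nat.Properties
  using ( ≤-refl; ≤-trans; <-≤-trans; <⇒≤; ≮⇒≥; <-cmp; _≟_; _<?_; n≤1+n; n<1+n; m≤n+m
        ; m≤n⇒m<n∨m≡n; suc-injective; *-suc; +-suc; <⇒<ᵇ; ≤⇒≤ᵇ; ≤ᵇ⇒≤ )
open import Data.Product using (_,_)
open import Data.Sum using (inj₁; inj₂)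
open import Relation.Nullary using (contradiction; yes; no)
open import Relation.Binary.Definitions using (tri<; tri≈; tri>)
import Relation.Binary.PropositionalEquality as ≡
open ≡ using (_≡_; _≢_)

isEven : ℕ → Bool
isEven zero          = true
isEven (suc zero)    = false
isEven (suc (suc n)) = isEven n

isEven-suc : ∀ n → isEven (suc n) ≡ not (isEven n)
isEven-suc zero          = ≡.refl
isEven-suc (suc zero)    = ≡.refl
isEven-suc (suc (suc n)) = isEven-suc n

isEven-suc-even : ∀ {n} → isEven n ≡ true → isEven (suc n) ≡ false
isEven-suc-even {n} en = ≡.trans (isEven-suc n) (≡.cong not en)

isEven-pred-odd : ∀ {n} → isEven (suc n) ≡ false → isEven n ≡ true
isEven-pred-odd {n} en = not-injective (≡.trans (≡.sym (isEven-suc n)) en)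

%2≡ᵇ0 : ∀ n → (n % 2 ≡ᵇ 0) ≡ isEven n
%2≡ᵇ0 zero          = ≡.refl
%2≡ᵇ0 (suc zero)    = ≡.refl
%2≡ᵇ0 (suc (suc n)) = %2≡ᵇ0 n

%2≡ᵇ1 : ∀ n → (n % 2 ≡ᵇ 1) ≡ not (isEven n)
%2≡ᵇ1 zero          = ≡.refl
%2≡ᵇ1 (suc zero)    = ≡.refl
%2≡ᵇ1 (suc (suc n)) = %2≡ᵇ1 n

<ᵇ-true : ∀ {m n} → m < n → (m <ᵇ n) ≡ true
<ᵇ-true m<n = Equivalence.to T-≡ (<⇒<ᵇ m<n)

<ᵇ-false : ∀ {m n} → n ≤ m → (m <ᵇ n) ≡ false
<ᵇ-false z≤n       = ≡.refl
<ᵇ-false (s≤s n≤m) = <ᵇ-false n≤m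

<ᵇ-asym : ∀ m n → (m <ᵇ n) ∧ (n <ᵇ m) ≡ false
<ᵇ-asym zero    zero    = ≡.refl
<ᵇ-asym zero    (suc n) = ≡.refl
<ᵇ-asym (suc m) zero    = ≡.refl
<ᵇ-asym (suc m) (suc n) = <ᵇ-asym m n

≤ᵇ-true : ∀ {m n} → m ≤ n → (m ≤ᵇ n) ≡ true
≤ᵇ-true m≤n = Equivalence.to T-≡ (≤⇒≤ᵇ m≤n)

≤ᵇ-false : ∀ {m n} → n < m → (m ≤ᵇ n) ≡ false
≤ᵇ-false {suc m} (s≤s n≤m) = <ᵇ-false n≤m

≤ᵇ-sound : ∀ m n → (m ≤ᵇ n) ≡ true → m ≤ n
≤ᵇ-sound m n eq = ≤ᵇ⇒≤ m n (Equivalence.from T-≡ eq)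

-- beyond a b: the neighbour b of the entry a lies on the side of a that the parity of a
-- requires (above a valley, below a peak); linked a b: a and b may be adjacent entries.
beyond : ℕ → ℕ → Bool
beyond a b = if isEven a then a <ᵇ b else b <ᵇ a

okAt-2 : ∀ p a n → okAt 2 p a n ≡ beyond a p ∧ beyond a n
okAt-2 p a n rewrite %2≡ᵇ0 a | %2≡ᵇ0 (suc a) | isEven-suc a with isEven a
... | true  = ∧-identityʳ _
... | false = ≡.refl

beyond-0 : ∀ a → beyond a 0 ≡ not (isEven a)
beyond-0 zero = ≡.refl
beyond-0 (suc a) with isEven (suc a)
... | true  = ≡.refl
... | false = ≡.refl

linked : ℕ → ℕ → Bool
linked a b = beyond a b ∧ beyond b a

linked-sym : ∀ a b → linked a b ≡ linked b a
linked-sym a b = ∧-comm (beyond a b) (beyond b a)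

linked-valley : ∀ {a b} → isEven a ≡ true → linked a b ≡ not (isEven b) ∧ (a <ᵇ b)
linked-valley {a} {b} ea rewrite ea with isEven b
... | true  = <ᵇ-asym a b
... | false = ∧-idem (a <ᵇ b)

linked-peak : ∀ {a b} → isEven a ≡ false → linked a b ≡ isEven b ∧ (b <ᵇ a)
linked-peak {a} {b} ea rewrite ea with isEven b
... | true  = ∧-idem (b <ᵇ a)
... | false = <ᵇ-asym b a

linked-parity : ∀ a b → linked a b ≡ true → isEven b ≡ not (isEven a)
linked-parity a b eq with isEven a | isEven b
... | true  | false = ≡.refl
... | false | true  = ≡.refl
... | true  | true  = contradiction (≡.trans (≡.sym (<ᵇ-asym a b)) eq) (not-¬ ≡.refl)
... | false | false = contradiction (≡.trans (≡.sym (<ᵇ-asym b a)) eq) (not-¬ ≡.refl)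

linked-0 : ∀ a → linked 0 a ≡ beyond a 0
linked-0 zero    = ≡.refl
linked-0 (suc a) = ≡.refl

linked-from-peak : ∀ {h b} → isEven h ≡ false → h ≤ b → linked h b ≡ false
linked-from-peak {h} {b} eh h≤b rewrite linked-peak {h} {b} eh | <ᵇ-false h≤b = ∧-zeroʳ (isEven b)

linked-to-valley : ∀ {j a} → isEven j ≡ true → j ≤ a → linked a j ≡ not (isEven a)
linked-to-valley {j} {a} ej j≤a rewrite linked-sym a j | linked-valley {j} {a} ej with isEven a in ea
... | true  = ≡.refl
... | false with m≤n⇒m<n∨m≡n j≤a
...   | inj₁ j<a    rewrite <ᵇ-true j<a = ≡.refl
...   | inj₂ ≡.refl = contradiction (≡.trans (≡.sym ej) ea) (not-¬ ≡.refl)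

linked-valley-suc : ∀ {j} → isEven j ≡ true → linked j (suc j) ≡ true
linked-valley-suc {j} ej
  rewrite linked-valley {j} {suc j} ej | isEven-suc j | ej | <ᵇ-true (n<1+n j) = ≡.refl

step : ℕ → ℕ → ℕ → Bool
step j a b = (j ≤ᵇ b) ∧ linked a b

step-level : ∀ j a b → step j a b ≡ true → j ≤ b
step-level j a b eq with j ≤ᵇ b in j≤b
... | true = ≤ᵇ-sound j b j≤b

step-linked : ∀ j a b → step j a b ≡ true → linked a b ≡ true
step-linked j a b eq with j ≤ᵇ b
... | true = eq

step-below : ∀ {j a b} → b < j → step j a b ≡ false
step-below b<j rewrite ≤ᵇ-false b<j = ≡.refl

step-at : ∀ j a → step j a j ≡ linked a j
step-at j a rewrite ≤ᵇ-true (≤-refl {j}) = ≡.refl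

step-off-level : ∀ {j a b} → b ≢ j → step j a b ≡ step (suc j) a b
step-off-level {j} {a} {b} b≢j with <-cmp b j
... | tri< b<j _ _ = ≡.trans (step-below b<j) (≡.sym (step-below (≤-trans b<j (n≤1+n j))))
... | tri≈ _ b≡j _ = contradiction b≡j b≢j
... | tri> _ _ j<b rewrite ≤ᵇ-true (<⇒≤ j<b) | ≤ᵇ-true j<b = ≡.refl

step-peak-stuck : ∀ {h} b → isEven h ≡ false → step h h b ≡ false
step-peak-stuck {h} b eh with b <? h
... | yes b<h = step-below b<h
... | no  b≮h rewrite linked-from-peak {h} {b} eh (≮⇒≥ b≮h) = ∧-zeroʳ _

step-peak-skip : ∀ {h b} c → isEven h ≡ false → h < b → step h b c ≡ step (suc h) b c
step-peak-skip {h} {b} c eh h<b with c ≟ h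
... | no c≢h     = step-off-level c≢h
... | yes ≡.refl = ≡.trans (step-at h b)
                     (≡.trans (linked-sym b h)
                     (≡.trans (linked-from-peak eh (<⇒≤ h<b)) (≡.sym (step-below (n<1+n h)))))

step-valley-shift : ∀ {j} b → isEven j ≡ true → step (suc (suc j)) j b ≡ step (suc (suc j)) (suc (suc j)) b
step-valley-shift {j} b ej with <-cmp b (suc (suc j))
... | tri< b<j+2 _ _ = ≡.trans (step-below b<j+2) (≡.sym (step-below b<j+2))
... | tri≈ _ ≡.refl _
  rewrite linked-valley {j} {b} ej | linked-valley {suc (suc j)} {b} ej | ej = ≡.refl
... | tri> _ _ j+2<b
  rewrite linked-valley {j} {b} ej | linked-valley {suc (suc j)} {b} ej
        | <ᵇ-true j+2<b | <ᵇ-true (≤-trans (n≤1+n (suc j)) (<⇒≤ j+2<b)) = ≡.refl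

module Sums {c ℓ} (R : CommutativeRing c ℓ) where
  open CommutativeRing R
  open Series R using (sumR)
  open import Relation.Binary.Reasoning.Setoid setoid

  when : Bool → Carrier → Carrier
  when b x = if b then x else 0#

  when-cong : ∀ b {x y} → (b ≡ true → x ≈ y) → when b x ≈ when b y
  when-cong true  x≈y = x≈y ≡.refl
  when-cong false _   = refl

  when-cong₂ : ∀ {b b′ x y} → b ≡ b′ → (b′ ≡ true → x ≈ y) → when b x ≈ when b′ y
  when-cong₂ ≡.refl = when-cong _

  when-false : ∀ {b} x → b ≡ false → when b x ≈ 0#
  when-false x ≡.refl = refl

  when-∧ : ∀ b b' x → when (b ∧ b') x ≡ when b (when b' x)
  when-∧ true  b' x = ≡.refl
  when-∧ false b' x = ≡.refl

  *-when : ∀ a b x → a * when b x ≈ when b (a * x)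
  *-when a true  x = refl
  *-when a false x = zeroʳ a

  when-+ : ∀ b x y → when b x + when b y ≈ when b (x + y)
  when-+ true  x y = refl
  when-+ false x y = +-identityʳ 0#

  sumR-cong : ∀ {A : Set} (xs : List A) {f g : A → Carrier} →
              (∀ x → f x ≈ g x) → sumR (map f xs) ≈ sumR (map g xs)
  sumR-cong []       f≈g = refl
  sumR-cong (x ∷ xs) f≈g = +-cong (f≈g x) (sumR-cong xs f≈g)

  sumR-++ : ∀ {A : Set} (xs ys : List A) (f : A → Carrier) →
            sumR (map f (xs ++ ys)) ≈ sumR (map f xs) + sumR (map f ys)
  sumR-++ []       ys f = sym (+-identityˡ _)
  sumR-++ (x ∷ xs) ys f = trans (+-congˡ (sumR-++ xs ys f)) (sym (+-assoc _ _ _))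

  sumR-concatMap : ∀ {A B : Set} (xs : List A) (g : A → List B) (f : B → Carrier) →
                   sumR (map f (concatMap g xs)) ≈ sumR (map (λ x → sumR (map f (g x))) xs)
  sumR-concatMap []       g f = refl
  sumR-concatMap (x ∷ xs) g f = trans (sumR-++ (g x) _ f) (+-congˡ (sumR-concatMap xs g f))

  sumR-*ˡ : ∀ {A : Set} (xs : List A) a (f : A → Carrier) →
            sumR (map (λ x → a * f x) xs) ≈ a * sumR (map f xs)
  sumR-*ˡ []       a f = sym (zeroʳ a)
  sumR-*ˡ (x ∷ xs) a f = trans (+-congˡ (sumR-*ˡ xs a f)) (sym (distribˡ a _ _))

  sumR-when : ∀ {A : Set} (xs : List A) b (f : A → Carrier) →
              sumR (map (λ x → when b (f x)) xs) ≈ when b (sumR (map f xs))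
  sumR-when []       true  f = refl
  sumR-when []       false f = refl
  sumR-when (x ∷ xs) b     f = trans (+-congˡ (sumR-when xs b f)) (when-+ b _ _)

  Σ< : ℕ → (ℕ → Carrier) → Carrier
  Σ< n F = sumR (applyUpTo F n)

  sumR-upTo : ∀ n (F : ℕ → Carrier) → sumR (map F (upTo n)) ≡ Σ< n F
  sumR-upTo n F = ≡.cong sumR (map-upTo F n)

  Σ<-cong : ∀ n {F G : ℕ → Carrier} → (∀ b → F b ≈ G b) → Σ< n F ≈ Σ< n G
  Σ<-cong zero    F≈G = refl
  Σ<-cong (suc n) F≈G = +-cong (F≈G 0) (Σ<-cong n (λ b → F≈G (suc b)))

  Σ<-zero : ∀ n {F : ℕ → Carrier} → (∀ b → b < n → F b ≈ 0#) → Σ< n F ≈ 0#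
  Σ<-zero zero    F≈0 = refl
  Σ<-zero (suc n) F≈0 =
    trans (+-cong (F≈0 0 (s≤s z≤n)) (Σ<-zero n (λ b b<n → F≈0 (suc b) (s≤s b<n)))) (+-identityʳ 0#)

  Σ<-extract : ∀ {n j} {F G : ℕ → Carrier} → j < n → (∀ b → b ≢ j → F b ≈ G b) → G j ≈ 0# →
               Σ< n F ≈ Σ< n G + F j
  Σ<-extract {suc n} {zero} {F} {G} _ F≈G G0≈0 = begin
    F 0 + Σ< n (λ b → F (suc b))        ≈⟨ +-comm _ _ ⟩
    Σ< n (λ b → F (suc b)) + F 0        ≈⟨ +-congʳ (Σ<-cong n (λ b → F≈G (suc b) λ ())) ⟩
    Σ< n (λ b → G (suc b)) + F 0        ≈⟨ +-congʳ (sym (+-identityˡ _)) ⟩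
    0# + Σ< n (λ b → G (suc b)) + F 0   ≈⟨ +-congʳ (+-congʳ (sym G0≈0)) ⟩
    G 0 + Σ< n (λ b → G (suc b)) + F 0  ∎
  Σ<-extract {suc n} {suc j} {F} {G} (s≤s j<n) F≈G Gj≈0 = begin
    F 0 + Σ< n (λ b → F (suc b))                ≈⟨ +-cong (F≈G 0 λ ()) (Σ<-extract j<n off-j Gj≈0) ⟩
    G 0 + (Σ< n (λ b → G (suc b)) + F (suc j))  ≈⟨ sym (+-assoc _ _ _) ⟩
    G 0 + Σ< n (λ b → G (suc b)) + F (suc j)    ∎
    where
    off-j : ∀ b → b ≢ j → F (suc b) ≈ G (suc b)
    off-j b b≢j = F≈G (suc b) (λ e → b≢j (suc-injective e))

-- Two levels of a continued fraction without division: P = 1/(-v - 1/(-w - p/q)) = N/(-v N - q).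
cf-step : ∀ {c ℓ} (S : CommutativeRing c ℓ) → let open CommutativeRing S in
          ∀ {P B P₂ q p v w N} →
          P ≈ B * (1# + v * P) → B ≈ w + P₂ → P₂ * q ≈ p → N ≈ - (w * q) - p →
          P * (- (v * N) - q) ≈ N
cf-step S {P} {B} {P₂} {q} {p} {v} {w} {N} P≈ B≈ P₂q≈p N≈ = begin
  P * (- (v * N) - q)                  ≈⟨ distribˡ P _ _ ⟩
  P * - (v * N) + P * - q              ≈⟨ +-cong (sym (-‿distribʳ-* P _)) (sym (-‿distribʳ-* P q)) ⟩
  - (P * (v * N)) + - (P * q)          ≈⟨ +-cong (-‿cong (x∙yz≈y∙xz P v N)) (-‿cong Pq≈) ⟩
  - (v * (P * N)) + - - (N + v * (P * N)) ≈⟨ +-congˡ (-‿involutive _) ⟩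
  - (v * (P * N)) + (N + v * (P * N))  ≈⟨ +-congˡ (+-comm N _) ⟩
  - (v * (P * N)) + (v * (P * N) + N)  ≈⟨ sym (+-assoc _ _ N) ⟩
  - (v * (P * N)) + v * (P * N) + N    ≈⟨ +-congʳ (-‿inverseˡ _) ⟩
  0# + N                               ≈⟨ +-identityˡ N ⟩
  N                                    ∎
  where
  open CommutativeRing S
  open RingProperties ring using (-‿distribʳ-*; -‿distribˡ-*; -‿involutive; -‿+-comm)
  open import Algebra.Properties.CommutativeSemigroup *-commutativeSemigroup
    using (x∙yz≈y∙xz; x∙yz≈y∙zx; xy∙z≈xz∙y)
  open import Relation.Binary.Reasoning.Setoid setoid

  Bq≈-N : B * q ≈ - N
  Bq≈-N = begin
    B * q              ≈⟨ *-congʳ B≈ ⟩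
    (w + P₂) * q       ≈⟨ distribʳ q w P₂ ⟩
    w * q + P₂ * q     ≈⟨ +-cong (sym (-‿involutive _)) (trans P₂q≈p (sym (-‿involutive p))) ⟩
    - - (w * q) + - - p ≈⟨ -‿+-comm _ _ ⟩
    - (- (w * q) - p)  ≈⟨ -‿cong (sym N≈) ⟩
    - N                ∎

  Pq≈ : P * q ≈ - (N + v * (P * N))
  Pq≈ = begin
    P * q                    ≈⟨ *-congʳ P≈ ⟩
    B * (1# + v * P) * q     ≈⟨ xy∙z≈xz∙y B _ q ⟩
    B * q * (1# + v * P)     ≈⟨ *-congʳ Bq≈-N ⟩
    - N * (1# + v * P)       ≈⟨ sym (-‿distribˡ-* N _) ⟩
    - (N * (1# + v * P))     ≈⟨ -‿cong (distribˡ N 1# _) ⟩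
    - (N * 1# + N * (v * P)) ≈⟨ -‿cong (+-cong (*-identityʳ N) (x∙yz≈y∙zx N v P)) ⟩
    - (N + v * (P * N))      ∎

module PowerSeries {c ℓ} (R : CommutativeRing c ℓ) where
  open CommutativeRing R
  open Series R
  open Sums R
  open RingProperties ring using (-0#≈0#; -‿distribˡ-*)
  open import Algebra.Properties.CommutativeSemigroup +-commutativeSemigroup
    using () renaming (interchange to +-interchange)
  open import Algebra.Properties.CommutativeSemigroup *-commutativeSemigroup
    using (x∙yz≈y∙xz)

  infix  4 _≋_
  infixl 6 _⊕_
  infixl 7 _⋆_ _•_
  infix  8 ⊖_ x·_

  _≋_ : Ser → Ser → Set ℓ
  f ≋ g = ∀ n → f n ≈ g n

  _⊕_ : Ser → Ser → Ser
  (f ⊕ g) n = f n + g n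

  ⊖_ : Ser → Ser
  (⊖ f) n = - f n

  0ₛ : Ser
  0ₛ _ = 0#

  _•_ : Carrier → Ser → Ser
  (a • f) n = a * f n

  x·_ : Ser → Ser
  (x· f) zero    = 0#
  (x· f) (suc n) = f n

  tail : Ser → Ser
  tail f n = f (suc n)

  _⋆_ : Ser → Ser → Ser
  (f ⋆ g) zero    = f 0 * g 0
  (f ⋆ g) (suc m) = f 0 * g (suc m) + (tail f ⋆ g) m

  ≋-trans : ∀ {f g h} → f ≋ g → g ≋ h → f ≋ h
  ≋-trans f≋g g≋h n = trans (f≋g n) (g≋h n)

  ⊕-cong : ∀ {f f′ g g′} → f ≋ f′ → g ≋ g′ → f ⊕ g ≋ f′ ⊕ g′
  ⊕-cong f≋f′ g≋g′ n = +-cong (f≋f′ n) (g≋g′ n)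

  ⋆-cong : ∀ {f f′ g g′} → f ≋ f′ → g ≋ g′ → f ⋆ g ≋ f′ ⋆ g′
  ⋆-cong f≋f′ g≋g′ zero    = *-cong (f≋f′ 0) (g≋g′ 0)
  ⋆-cong f≋f′ g≋g′ (suc m) =
    +-cong (*-cong (f≋f′ 0) (g≋g′ (suc m))) (⋆-cong (λ n → f≋f′ (suc n)) g≋g′ m)

  ⋆-zeroˡ : ∀ g → 0ₛ ⋆ g ≋ 0ₛ
  ⋆-zeroˡ g zero    = zeroˡ (g 0)
  ⋆-zeroˡ g (suc m) = trans (+-cong (zeroˡ _) (⋆-zeroˡ g m)) (+-identityʳ 0#)

  ⋆-distribˡ : ∀ f g h → f ⋆ (g ⊕ h) ≋ f ⋆ g ⊕ f ⋆ h
  ⋆-distribˡ f g h zero    = distribˡ (f 0) (g 0) (h 0)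
  ⋆-distribˡ f g h (suc m) =
    trans (+-cong (distribˡ (f 0) _ _) (⋆-distribˡ (tail f) g h m)) (+-interchange _ _ _ _)

  ⋆-distribʳ : ∀ h f g → (f ⊕ g) ⋆ h ≋ f ⋆ h ⊕ g ⋆ h
  ⋆-distribʳ h f g zero    = distribʳ (h 0) (f 0) (g 0)
  ⋆-distribʳ h f g (suc m) =
    trans (+-cong (distribʳ (h (suc m)) _ _) (⋆-distribʳ h (tail f) (tail g) m)) (+-interchange _ _ _ _)

  •-⋆ : ∀ a f g → (a • f) ⋆ g ≋ a • (f ⋆ g)
  •-⋆ a f g zero    = *-assoc a (f 0) (g 0)
  •-⋆ a f g (suc m) = trans (+-cong (*-assoc a _ _) (•-⋆ a (tail f) g m)) (sym (distribˡ a _ _))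

  ⋆-• : ∀ a f g → f ⋆ (a • g) ≋ a • (f ⋆ g)
  ⋆-• a f g zero    = x∙yz≈y∙xz (f 0) a (g 0)
  ⋆-• a f g (suc m) = trans (+-cong (x∙yz≈y∙xz _ a _) (⋆-• a (tail f) g m)) (sym (distribˡ a _ _))

  x·-⋆ : ∀ f g → x· f ⋆ g ≋ x· (f ⋆ g)
  x·-⋆ f g zero    = zeroˡ (g 0)
  x·-⋆ f g (suc m) = trans (+-congʳ (zeroˡ _)) (+-identityˡ _)

  ⋆-x· : ∀ f g → f ⋆ x· g ≋ x· (f ⋆ g)
  ⋆-x· f g zero          = zeroʳ (f 0)
  ⋆-x· f g (suc zero)    = trans (+-congˡ (⋆-x· (tail f) g 0)) (+-identityʳ _)
  ⋆-x· f g (suc (suc m)) = +-congˡ (⋆-x· (tail f) g (suc m))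

  ⋆-identityʳ : ∀ f → f ⋆ one ≋ f
  ⋆-identityʳ f zero    = *-identityʳ (f 0)
  ⋆-identityʳ f (suc m) = trans (+-cong (zeroʳ (f 0)) (⋆-identityʳ (tail f) m)) (+-identityˡ _)

  ≋-head+x·tail : ∀ f → f ≋ f 0 • one ⊕ x· tail f
  ≋-head+x·tail f zero    = sym (trans (+-identityʳ _) (*-identityʳ _))
  ≋-head+x·tail f (suc n) = sym (trans (+-congʳ (zeroʳ _)) (+-identityˡ _))

  ⋆-unfoldˡ : ∀ f g → f ⋆ g ≋ f 0 • g ⊕ x· (tail f ⋆ g)
  ⋆-unfoldˡ f g zero    = sym (+-identityʳ _)
  ⋆-unfoldˡ f g (suc m) = refl

  ⋆-unfoldʳ : ∀ f g → f ⋆ g ≋ g 0 • f ⊕ x· (f ⋆ tail g)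
  ⋆-unfoldʳ f g =
    ≋-trans (⋆-cong (λ _ → refl) (≋-head+x·tail g))
    (≋-trans (⋆-distribˡ f _ _)
    (⊕-cong (≋-trans (⋆-• (g 0) f one) (λ n → *-congˡ (⋆-identityʳ f n))) (⋆-x· f (tail g))))

  ⋆-comm : ∀ f g → f ⋆ g ≋ g ⋆ f
  ⋆-comm f g zero    = *-comm (f 0) (g 0)
  ⋆-comm f g (suc m) = trans (+-congˡ (⋆-comm (tail f) g m)) (sym (⋆-unfoldʳ g f (suc m)))

  ⋆-identityˡ : ∀ f → one ⋆ f ≋ f
  ⋆-identityˡ f = ≋-trans (⋆-comm one f) (⋆-identityʳ f)

  ⋆-assoc : ∀ f g h → (f ⋆ g) ⋆ h ≋ f ⋆ (g ⋆ h)
  ⋆-assoc f g h zero    = *-assoc (f 0) (g 0) (h 0)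
  ⋆-assoc f g h (suc m) = trans (unfolded (suc m)) (+-congˡ (⋆-assoc (tail f) g h m))
    where
    unfolded : (f ⋆ g) ⋆ h ≋ f 0 • (g ⋆ h) ⊕ x· ((tail f ⋆ g) ⋆ h)
    unfolded = ≋-trans (⋆-cong (⋆-unfoldˡ f g) (λ _ → refl))
               (≋-trans (⋆-distribʳ h _ _) (⊕-cong (•-⋆ (f 0) g h) (x·-⋆ (tail f ⋆ g) h)))

  commutativeRing : CommutativeRing c ℓ
  commutativeRing = record
    { Carrier           = Ser
    ; _≈_               = _≋_
    ; _+_               = _⊕_
    ; _*_               = _⋆_
    ; -_                = ⊖_
    ; 0#                = 0ₛ
    ; 1#                = one
    ; isCommutativeRing = record
      { isRing = record
        { +-isAbelianGroup = Pointwise.isAbelianGroup ℕ +-isAbelianGroup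
        ; *-cong           = ⋆-cong
        ; *-assoc          = ⋆-assoc
        ; *-identity       = ⋆-identityˡ , ⋆-identityʳ
        ; distrib          = ⋆-distribˡ , ⋆-distribʳ
        }
      ; *-comm = ⋆-comm
      }
    }

  ⊛≋⋆ : ∀ f g → f ⊛ g ≋ f ⋆ g
  ⊛≋⋆ f g m = trans (reflexive (sumR-upTo (suc m) _)) (convolution m f)
    where
    convolution : ∀ m f → Σ< (suc m) (λ i → f i * g (m ∸ i)) ≈ (f ⋆ g) m
    convolution zero    f = +-identityʳ _
    convolution (suc m) f = +-congˡ (convolution m (tail f))

  cx≋⋆ : ∀ a f → cx a f ≋ cx a one ⋆ f
  cx≋⋆ a f zero    = sym (zeroˡ (f 0))
  cx≋⋆ a f (suc m) = sym (begin
    0# * f (suc m) + ((a • one) ⋆ f) m ≈⟨ +-congʳ (zeroˡ _) ⟩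
    0# + ((a • one) ⋆ f) m            ≈⟨ +-identityˡ _ ⟩
    ((a • one) ⋆ f) m                 ≈⟨ •-⋆ a one f m ⟩
    a * (one ⋆ f) m                   ≈⟨ *-congˡ (⋆-identityˡ f m) ⟩
    a * f m                           ∎)
    where open import Relation.Binary.Reasoning.Setoid setoid

  cx-neg : ∀ a f → cx (- a) f ≋ ⊖ cx a f
  cx-neg a f zero    = sym -0#≈0#
  cx-neg a f (suc m) = sym (-‿distribˡ-* a (f m))

  when•-⋆ : ∀ e a f g → (λ n → when e (a * f n)) ⋆ g ≋ (λ m → when e (a * (f ⋆ g) m))
  when•-⋆ true  a f g = •-⋆ a f g
  when•-⋆ false a f g = ⋆-zeroˡ g

  Σ<-⋆ : ∀ n (F : ℕ → Ser) g →
         (λ k → Σ< n (λ b → F b k)) ⋆ g ≋ (λ m → Σ< n (λ b → (F b ⋆ g) m))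
  Σ<-⋆ zero    F g = ⋆-zeroˡ g
  Σ<-⋆ (suc n) F g = ≋-trans (⋆-distribʳ g (F 0) _) (λ m → +-congˡ (Σ<-⋆ n (λ b → F (suc b)) g m))

module Walks {c ℓ} (R : CommutativeRing c ℓ) (V : ℕ → CommutativeRing.Carrier R) (K : ℕ) where
  open CommutativeRing R
  open Series R
  open Sums R
  open PowerSeries R
  open RingProperties ring using (-0#≈0#)
  open import Relation.Binary.Reasoning.Setoid setoid

  -- walks j a N is the weighted sum over the continuations (b₁, …, b_N) ∈ [j, K]ᴺ of an entry a:
  -- consecutive entries are linked, and the last entry (a itself when N = 0) is a peak since it
  -- is followed by a_{N+1} = 0.
  walks : ℕ → ℕ → Ser
  walks j a zero    = if isEven a then 0# else 1#
  walks j a (suc N) = Σ< (suc K) (λ b → when (step j a b) (V b * walks j b N))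

  Σ-step-peel : ∀ {j} a (g : ℕ → Carrier) → j ≤ K →
                Σ< (suc K) (λ b → when (step j a b) (g b))
                  ≈ Σ< (suc K) (λ b → when (step (suc j) a b) (g b)) + when (linked a j) (g j)
  Σ-step-peel {j} a g j≤K =
    trans (Σ<-extract (s≤s j≤K) off-level (when-false (g j) (step-below (n<1+n j))))
          (+-congˡ (when-cong₂ (step-at j a) (λ _ → refl)))
    where
    off-level : ∀ b → b ≢ j → when (step j a b) (g b) ≈ when (step (suc j) a b) (g b)
    off-level b b≢j = when-cong₂ (step-off-level b≢j) (λ _ → refl)

  walks-parity : ∀ j N a → isEven a ≡ isEven N → walks j a N ≈ 0#
  walks-parity j zero    a ea rewrite ea = refl
  walks-parity j (suc N) a ea = Σ<-zero (suc K) (λ b _ → vanishes b)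
    where
    vanishes : ∀ b → when (step j a b) (V b * walks j b N) ≈ 0#
    vanishes b with step j a b in eq
    ... | false = refl
    ... | true  = trans (*-congˡ (walks-parity j N b parity)) (zeroʳ (V b))
      where
      parity : isEven b ≡ isEven N
      parity = ≡.trans (linked-parity a b (step-linked j a b eq))
               (≡.trans (≡.cong not (≡.trans ea (isEven-suc N))) (not-involutive (isEven N)))

  walks-top : ∀ {j} → isEven j ≡ true → K < j → walks j j ≋ 0ₛ
  walks-top ej K<j zero    rewrite ej = refl
  walks-top {j} ej K<j (suc m) =
    Σ<-zero (suc K) λ b b≤K →
      when-false (V b * walks j b m) (step-below {j} {j} {b} (<-≤-trans b≤K K<j))

  walks-peak : ∀ {h} → isEven h ≡ false → walks h h ≋ one
  walks-peak eh zero    rewrite eh = refl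
  walks-peak {h} eh (suc m) =
    Σ<-zero (suc K) λ b _ → when-false (V b * walks h b m) (step-peak-stuck {h} b eh)

  walks-peak-skip : ∀ {h} → isEven h ≡ false → ∀ {b} → h < b → walks h b ≋ walks (suc h) b
  walks-peak-skip eh h<b zero    = refl
  walks-peak-skip {h} eh {b} h<b (suc m) = Σ<-cong (suc K) skip
    where
    skip : ∀ c → when (step h b c) (V c * walks h c m) ≈ when (step (suc h) b c) (V c * walks (suc h) c m)
    skip c = when-cong₂ (step-peak-skip c eh h<b)
               (λ e → *-congˡ (walks-peak-skip eh (step-level (suc h) b c e) m))

  -- Cut a walk at its first visit to the valley j: before it comes a walk above j, whose last
  -- entry is odd because it is linked to j, and after it a walk from j.
  walks-first-visit : ∀ {j} → isEven j ≡ true → j ≤ K → ∀ {a} → j ≤ a →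
                      walks j a ≋ walks (suc j) a ⋆ (one ⊕ cx (V j) (walks j j))
  walks-first-visit ej j≤K j≤a zero = sym (trans (*-congˡ (+-identityʳ 1#)) (*-identityʳ _))
  walks-first-visit {j} ej j≤K {a} j≤a (suc m) = begin
    walks j a (suc m)
      ≈⟨ Σ-step-peel a (λ b → V b * walks j b m) j≤K ⟩
    Σ< (suc K) (λ b → when (step (suc j) a b) (V b * walks j b m)) + when (linked a j) (V j * walks j j m)
      ≈⟨ +-cong (sym above)
                (trans (when-cong₂ (linked-to-valley ej j≤a) (λ _ → refl)) (through-j (isEven a))) ⟩
    (tail (walks (suc j) a) ⋆ after) m + walks (suc j) a 0 * after (suc m)
      ≈⟨ +-comm _ _ ⟩
    (walks (suc j) a ⋆ after) (suc m) ∎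
    where
    after : Ser
    after = one ⊕ cx (V j) (walks j j)
    above : (tail (walks (suc j) a) ⋆ after) m ≈ Σ< (suc K) (λ b → when (step (suc j) a b) (V b * walks j b m))
    above = trans (Σ<-⋆ (suc K) (λ b n → when (step (suc j) a b) (V b * walks (suc j) b n)) after m)
            (Σ<-cong (suc K) λ b → trans (when•-⋆ (step (suc j) a b) (V b) (walks (suc j) b) after m)
              (when-cong (step (suc j) a b) λ e → *-congˡ (sym
                (walks-first-visit ej j≤K (≤-trans (n≤1+n j) (step-level (suc j) a b e)) m))))
    through-j : ∀ e → when (not e) (V j * walks j j m) ≈ (if e then 0# else 1#) * (0# + V j * walks j j m)
    through-j true  = sym (zeroˡ _)
    through-j false = sym (trans (*-identityˡ _) (+-identityˡ _))

  -- Above j, the first step from the valley j reaches either the peak j + 1, which ends the walk,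
  -- or an odd entry above j + 2, exactly like a first step from the valley j + 2.
  walks-valley-start : ∀ {j} → isEven j ≡ true → suc j ≤ K →
                       walks (suc j) j ≋ cx (V (suc j)) one ⊕ walks (suc (suc j)) (suc (suc j))
  walks-valley-start ej j<K zero = sym (+-identityˡ _)
  walks-valley-start {j} ej j<K (suc m) = begin
    walks (suc j) j (suc m)
      ≈⟨ Σ-step-peel j (λ b → V b * walks (suc j) b m) j<K ⟩
    Σ< (suc K) (λ b → when (step (suc (suc j)) j b) (V b * walks (suc j) b m))
      + when (linked j (suc j)) (V (suc j) * walks (suc j) (suc j) m)
      ≈⟨ +-cong (Σ<-cong (suc K) shift) first ⟩
    walks (suc (suc j)) (suc (suc j)) (suc m) + V (suc j) * one m
      ≈⟨ +-comm _ _ ⟩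
    (cx (V (suc j)) one ⊕ walks (suc (suc j)) (suc (suc j))) (suc m) ∎
    where
    shift : ∀ b → when (step (suc (suc j)) j b) (V b * walks (suc j) b m)
                    ≈ when (step (suc (suc j)) (suc (suc j)) b) (V b * walks (suc (suc j)) b m)
    shift b = when-cong₂ (step-valley-shift b ej) λ e →
      *-congˡ (walks-peak-skip (isEven-suc-even {j} ej) (step-level (suc (suc j)) (suc (suc j)) b e) m)
    first : when (linked j (suc j)) (V (suc j) * walks (suc j) (suc j) m) ≈ V (suc j) * one m
    first = when-cong₂ (linked-valley-suc {j} ej) (λ _ → *-congˡ (walks-peak (isEven-suc-even {j} ej) m))

  Expands : Ser → Frac → Set ℓ
  Expands P F = P ⋆ Frac.den F ≋ Frac.num F

  expands-cf-step : ∀ {j} → isEven j ≡ true → suc j ≤ K → ∀ {q p N} →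
                    Expands (walks (suc (suc j)) (suc (suc j))) (p / q) → N ≋ cx (- V (suc j)) q ⊝ p →
                    Expands (walks j j) (N / (cx (- V j) N ⊝ q))
  expands-cf-step {j} ej j<K {q} {p} {N} P₂q≈p N≈ =
    𝕊.trans (𝕊.*-congˡ (𝕊.+-congʳ (as-product N)))
            (cf-step commutativeRing first-visit (walks-valley-start ej j<K) P₂q≈p
                     (𝕊.trans N≈ (𝕊.+-congʳ (as-product q))))
    where
    module 𝕊 = CommutativeRing commutativeRing
    as-product : ∀ {a} f → cx (- a) f ≋ ⊖ (cx a one ⋆ f)
    as-product {a} f = 𝕊.trans (cx-neg a f) (𝕊.-‿cong (cx≋⋆ a f))
    first-visit : walks j j ≋ walks (suc j) j ⋆ (one ⊕ cx (V j) one ⋆ walks j j)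
    first-visit = 𝕊.trans (walks-first-visit ej (<⇒≤ j<K) ≤-refl)
                          (𝕊.*-congˡ (𝕊.+-congˡ (cx≋⋆ (V j) (walks j j))))

  walks-expands-cf : ∀ r {j} → isEven j ≡ true → isEven r ≡ true → r Nat.+ suc j ≡ K →
                     Expands (walks j j) (cf V j (suc r))
  walks-expands-cf zero {j} ej _ j+1≡K =
    expands-cf-step ej (≡.subst (suc j ≤_) j+1≡K ≤-refl) empty-above (λ _ → sym (minus-0 _))
    where
    empty-above : Expands (walks (suc (suc j)) (suc (suc j))) (0ₛ / one)
    empty-above = ≋-trans (⋆-identityʳ _)
                          (walks-top ej (≡.subst (_< suc (suc j)) j+1≡K (n<1+n (suc j))))
    minus-0 : ∀ x → x - 0# ≈ x
    minus-0 x = trans (+-congˡ -0#≈0#) (+-identityʳ x)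
  walks-expands-cf (suc (suc r)) {j} ej er eq =
    expands-cf-step ej (≡.subst (suc j ≤_) eq (m≤n+m (suc j) (suc (suc r))))
      (walks-expands-cf r ej er (≡.trans (+-suc r _) (≡.trans (≡.cong suc (+-suc r (suc j))) eq)))
      (λ _ → refl)

  sumR-seqs-suc : ∀ N (f : List ℕ → Carrier) →
                  sumR (map f (seqs (suc N) K))
                    ≈ sumR (map (λ b → sumR (map (λ t → f (b ∷ t)) (seqs N K))) (upTo (suc K)))
  sumR-seqs-suc N f =
    trans (sumR-concatMap (upTo (suc K)) (λ b → map (b ∷_) (seqs N K)) f)
          (sumR-cong (upTo (suc K)) (λ b → reflexive (≡.cong sumR (≡.sym (map-∘ (seqs N K))))))

  tails-sum : ∀ N p a → sumR (map (λ t → when (isPVFrom 2 p (a ∷ t)) (wt V t)) (seqs N K))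
                          ≈ when (beyond a p) (walks 0 a N)
  tails-sum zero p a =
    trans (+-congʳ (when-cong₂ (≡.cong (_∧ true) condition) (λ _ → refl)))
          (last-entry (beyond a p) (isEven a))
    where
    condition : okAt 2 p a 0 ≡ beyond a p ∧ not (isEven a)
    condition = ≡.trans (okAt-2 p a 0) (≡.cong (beyond a p ∧_) (beyond-0 a))
    last-entry : ∀ x e → when ((x ∧ not e) ∧ true) 1# + 0# ≈ when x (if e then 0# else 1#)
    last-entry true  true  = +-identityʳ _
    last-entry true  false = +-identityʳ _
    last-entry false _     = +-identityʳ _
  tails-sum (suc N) p a = begin
    sumR (map (λ t → when (isPVFrom 2 p (a ∷ t)) (wt V t)) (seqs (suc N) K))
      ≈⟨ sumR-seqs-suc N _ ⟩
    sumR (map (λ b → sumR (map (λ t → when (isPVFrom 2 p (a ∷ b ∷ t)) (V b * wt V t)) ts)) (upTo (suc K)))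
      ≈⟨ sumR-cong (upTo (suc K)) next ⟩
    sumR (map (λ b → when (beyond a p) (when (step 0 a b) (V b * walks 0 b N))) (upTo (suc K)))
      ≈⟨ sumR-when (upTo (suc K)) (beyond a p) _ ⟩
    when (beyond a p) (sumR (map (λ b → when (step 0 a b) (V b * walks 0 b N)) (upTo (suc K))))
      ≡⟨ ≡.cong (when (beyond a p)) (sumR-upTo (suc K) _) ⟩
    when (beyond a p) (walks 0 a (suc N)) ∎
    where
    ts : List (List ℕ)
    ts = seqs N K
    valid : ℕ → List ℕ → Carrier
    valid b t = when (isPVFrom 2 a (b ∷ t)) (wt V t)
    next : ∀ b → sumR (map (λ t → when (isPVFrom 2 p (a ∷ b ∷ t)) (V b * wt V t)) ts)
                   ≈ when (beyond a p) (when (step 0 a b) (V b * walks 0 b N))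
    next b = begin
      sumR (map (λ t → when (isPVFrom 2 p (a ∷ b ∷ t)) (V b * wt V t)) ts)
        ≈⟨ sumR-cong ts guards ⟩
      sumR (map (λ t → when (beyond a p) (when (beyond a b) (V b * valid b t))) ts)
        ≈⟨ sumR-when ts (beyond a p) _ ⟩
      when (beyond a p) (sumR (map (λ t → when (beyond a b) (V b * valid b t)) ts))
        ≈⟨ when-cong (beyond a p) (λ _ → sumR-when ts (beyond a b) _) ⟩
      when (beyond a p) (when (beyond a b) (sumR (map (λ t → V b * valid b t) ts)))
        ≈⟨ when-cong (beyond a p) (λ _ → when-cong (beyond a b) λ _ → sumR-*ˡ ts (V b) (valid b)) ⟩
      when (beyond a p) (when (beyond a b) (V b * sumR (map (valid b) ts)))
        ≈⟨ when-cong (beyond a p) (λ _ → when-cong (beyond a b) λ _ →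
             trans (*-congˡ (tails-sum N a b)) (*-when (V b) _ _)) ⟩
      when (beyond a p) (when (beyond a b) (when (beyond b a) (V b * walks 0 b N)))
        ≡⟨ ≡.cong (when (beyond a p)) (≡.sym (when-∧ (beyond a b) (beyond b a) _)) ⟩
      when (beyond a p) (when (step 0 a b) (V b * walks 0 b N)) ∎
      where
      guards : ∀ t → when (isPVFrom 2 p (a ∷ b ∷ t)) (V b * wt V t)
                       ≈ when (beyond a p) (when (beyond a b) (V b * valid b t))
      guards t rewrite okAt-2 p a b
                     | when-∧ (beyond a p ∧ beyond a b) (isPVFrom 2 a (b ∷ t)) (V b * wt V t)
                     | when-∧ (beyond a p) (beyond a b) (when (isPVFrom 2 a (b ∷ t)) (V b * wt V t))
        = when-cong (beyond a p) λ _ → when-cong (beyond a b) λ _ → sym (*-when (V b) _ _)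

  PV-sum : ∀ N → sumR (map (wt V) (PV 2 K (suc N))) ≈ walks 0 0 (suc N)
  PV-sum N = begin
    sumR (map (wt V) (PV 2 K (suc N)))
      ≈⟨ sumR-concatMap (seqs (suc N) K) _ (wt V) ⟩
    sumR (map (λ π → sumR (map (wt V) (if isPV 2 π then [ π ] else []))) (seqs (suc N) K))
      ≈⟨ sumR-cong (seqs (suc N) K) (λ π → singleton (isPV 2 π)) ⟩
    sumR (map (λ π → when (isPV 2 π) (wt V π)) (seqs (suc N) K))
      ≈⟨ sumR-seqs-suc N _ ⟩
    sumR (map (λ a → sumR (map (λ t → when (isPVFrom 2 0 (a ∷ t)) (V a * wt V t)) (seqs N K))) (upTo (suc K)))
      ≈⟨ sumR-cong (upTo (suc K)) first ⟩
    sumR (map (λ a → when (step 0 0 a) (V a * walks 0 a N)) (upTo (suc K)))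
      ≡⟨ sumR-upTo (suc K) _ ⟩
    walks 0 0 (suc N) ∎
    where
    singleton : ∀ {π} b → sumR (map (wt V) (if b then [ π ] else [])) ≈ when b (wt V π)
    singleton true  = +-identityʳ _
    singleton false = refl
    first : ∀ a → sumR (map (λ t → when (isPVFrom 2 0 (a ∷ t)) (V a * wt V t)) (seqs N K))
                    ≈ when (step 0 0 a) (V a * walks 0 a N)
    first a = begin
      sumR (map (λ t → when (isPVFrom 2 0 (a ∷ t)) (V a * wt V t)) (seqs N K))
        ≈⟨ sumR-cong (seqs N K) (λ t → sym (*-when (V a) _ _)) ⟩
      sumR (map (λ t → V a * when (isPVFrom 2 0 (a ∷ t)) (wt V t)) (seqs N K))
        ≈⟨ sumR-*ˡ (seqs N K) (V a) _ ⟩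
      V a * sumR (map (λ t → when (isPVFrom 2 0 (a ∷ t)) (wt V t)) (seqs N K))
        ≈⟨ *-congˡ (tails-sum N 0 a) ⟩
      V a * when (beyond a 0) (walks 0 a N)
        ≈⟨ *-when (V a) _ _ ⟩
      when (beyond a 0) (V a * walks 0 a N)
        ≡⟨ ≡.cong (λ e → when e (V a * walks 0 a N)) (≡.sym (linked-0 a)) ⟩
      when (step 0 0 a) (V a * walks 0 a N) ∎

  pvGF≋walks : pvGF V K ≋ walks 0 0
  pvGF≋walks zero    = refl
  pvGF≋walks (suc N) =
    trans (when-cong₂ (%2≡ᵇ1 (suc N)) (λ _ → refl)) (odd-length (isEven (suc N)) ≡.refl)
    where
    odd-length : ∀ e → isEven (suc N) ≡ e →
                 when (not e) (sumR (map (wt V) (PV 2 K (suc N)))) ≈ walks 0 0 (suc N)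
    odd-length true  even = sym (walks-parity 0 (suc N) 0 (≡.sym even))
    odd-length false _    = PV-sum N

pvGF-continuedFraction : ∀ {c ℓ} (R : CommutativeRing c ℓ) (V : ℕ → CommutativeRing.Carrier R)
                           (K : ℕ) → isEven K ≡ false →
                         let open CommutativeRing R using (_≈_)
                             open Series R
                             F = cf V 0 K
                         in ∀ m → (pvGF V K ⊛ Frac.den F) m ≈ Frac.num F m
pvGF-continuedFraction R V (suc r) odd-K =
  ≋-trans (⊛≋⋆ _ _)
  (≋-trans (⋆-cong pvGF≋walks (λ _ → refl))
           (walks-expands-cf r ≡.refl (isEven-pred-odd {r} odd-K) (ℕₚ.+-comm r 1)))
  where
  open CommutativeRing R using (refl)
  open PowerSeries R
  open Walks R V (suc r)

open import Data.Nat using (_*_)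

isEven-2* : ∀ n → isEven (2 * n) ≡ true
isEven-2* zero                     = ≡.refl
isEven-2* (suc n) rewrite *-suc 2 n = isEven-2* n

isEven-2*-1 : ∀ {k} → 1 ≤ k → isEven (2 * k ∸ 1) ≡ false
isEven-2*-1 {suc k} _ = ≡.trans (≡.cong (λ n → isEven (n ∸ 1)) (*-suc 2 k))
                                (≡.trans (isEven-suc (2 * k)) (≡.cong not (isEven-2* k)))

proposition3p4 : ∀ {c ℓ} (R : CommutativeRing c ℓ) (V : ℕ → CommutativeRing.Carrier R)
                   (k : ℕ) → 1 ≤ k →
                   let open CommutativeRing R using (_≈_)
                       open Series R
                       F = cf V 0 (2 * k ∸ 1)
                   in ∀ m → (pvGF V (2 * k ∸ 1) ⊛ Frac.den F) m ≈ Frac.num F m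
proposition3p4 R V k 1≤k = pvGF-continuedFraction R V (2 * k ∸ 1) (isEven-2*-1 1≤k)
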